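{- Let $m\ge 2$, take the vertex set of $K_{2m+1}$ to be $\{\infty\}\cup\mathbb{Z}_{2m}$, and for $i\in[m]$ let $H_i$ be the Hamiltonian cycle $\infty,\ i,\ i+1,\ i-1,\ i+2,\ i-2,\ \dots,\ i+(m-1),\ i-(m-1),\ i+m,\ \infty$ (arithmetic in $\mathbb{Z}_{2m}$). Let $\ell_i$ be the ordering of $H_i$ given by $\ell_i(\{\infty,i\})=0$, $\ell_i(\{\infty,i+m\})=m$, $\ell_i(\{i+x,i-x\})=x$ for $x\in[m]\setminus\{0\}$, and $\ell_i(\{i+x,i-x+1\})=m+x$ for $x\in[m+1]\setminus\{0\}$. Let $i,j\in[m]$. If $i<j$, then $ms(\ell_i,\ell_j)\ge m+1-(j-i)$ and $ms_3(\ell_i,\ell_j)\ge 3m+1-(j-i)$. If $i>j$, then $ms(\ell_i,\ell_j)\ge m-(i-j)$ and $ms_3(\ell_i,\ell_j)\ge 3m+2-(i-j)$.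
   Context: For an integer $N$, $[N]=\{0,\dots,N-1\}$. An ordering of a graph $H=(V,E)$ is a bijection $E\to[|E|]$. A graph is $(\le r)$-regular if each vertex has degree at most $r$. For edge-disjoint graphs $H,H'$ on the same vertex set with orderings $\ell,\ell'$, consider the list of edges of $H$ in the order given by $\ell$ followed by the edges of $H'$ in the order given by $\ell'$; $ms_r(\ell,\ell')$ is the largest integer $s$ such that every $s$ consecutive entries of this list that include at least one edge of $H$ and at least one edge of $H'$ form a $(\le r)$-regular graph; $ms=ms_1$. -}

module Defs where

open import Data.Nat using (ℕ; zero; suc; _+_; _*_; _∸_; _≤_; _<_; _<ᵇ_)
open import Data.Nat.Properties using () renaming (_≟_ to _≟ℕ_)
open import Data.Bool using (Bool; true; false; if_then_else_; _∨_)
open import Data.Maybe using (Maybe; just; nothing)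
open import Data.Maybe.Properties using (≡-dec)
open import Data.Product using (Σ; _×_; _,_)
open import Relation.Nullary.Decidable using (⌊_⌋)

-- Vertices of K_{2m+1}: {∞} ∪ Z_{2m}.  'nothing' is ∞, 'just a' is the
-- residue a (we always keep a in the range [0, 2m)).
Vertex : Set
Vertex = Maybe ℕ

∞ : Vertex
∞ = nothing

-- An edge {u,v}, stored as an (unordered-in-meaning) pair of endpoints.
Edge : Set
Edge = Vertex × Vertex

_≟V_ = ≡-dec _≟ℕ_

incident : Vertex → Edge → Bool
incident v (a , b) = ⌊ v ≟V a ⌋ ∨ ⌊ v ≟V b ⌋

-- reduction modulo 2m, valid for arguments a < 4m (all uses below)
red : ℕ → ℕ → ℕ
red m a = if a <ᵇ 2 * m then a else a ∸ 2 * m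

-- the element i + x of Z_{2m}  (i, x ≤ 2m)
_⊕[_]_ : ℕ → ℕ → ℕ → Vertex
i ⊕[ m ] x = just (red m (i + x))

-- the element i - x of Z_{2m}  (i < m, x ≤ 2m)
_⊖[_]_ : ℕ → ℕ → ℕ → Vertex
i ⊖[ m ] x = just (red m (i + (2 * m ∸ x)))

-- ℓ_i^{-1}: the edge of H_i at position k (0 ≤ k ≤ 2m) of the ordering ℓ_i:
--   ℓ_i({∞,i}) = 0,  ℓ_i({i+x,i-x}) = x (1 ≤ x ≤ m-1),
--   ℓ_i({∞,i+m}) = m, ℓ_i({i+x,i-x+1}) = m+x (1 ≤ x ≤ m).
edgeAt : (m i k : ℕ) → Edge
edgeAt m i zero = (∞ , i ⊕[ m ] 0)
edgeAt m i (suc k) =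
  if suc k <ᵇ m then (i ⊕[ m ] suc k , i ⊖[ m ] suc k)
  else if suc k <ᵇ suc m then (∞ , i ⊕[ m ] m)
  else ((i ⊕[ m ] (suc k ∸ m)) , ((i + 1) ⊖[ m ] (suc k ∸ m)))

-- Generic machinery for ms_r.
-- A graph H with an ordering is given as the list of its edges in order,
-- i.e. a function L : ℕ → Edge read on positions [0, n) (n = |E(H)|).

concatE : (ℕ → Edge) → ℕ → (ℕ → Edge) → ℕ → Edge
concatE L n L' q = if q <ᵇ n then L q else L' (q ∸ n)

countFrom : (ℕ → Bool) → ℕ → ℕ → ℕ
countFrom f p zero = 0
countFrom f p (suc s) =
  (if f (p + s) then 1 else 0) + countFrom f p s

-- every s consecutive entries (positions p, …, p+s-1) of the concatenated
-- list containing at least one edge of H (p < n) and one edge of H'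
-- (n < p + s) form a (≤ r)-regular graph (every vertex has degree ≤ r)
WindowsOK : (r : ℕ) → (L : ℕ → Edge) → (n : ℕ) → (L' : ℕ → Edge) → (n' : ℕ)
          → (s : ℕ) → Set
WindowsOK r L n L' n' s =
  ∀ p → p < n → n < p + s → p + s ≤ n + n' →
  ∀ (v : Vertex) → countFrom (λ q → incident v (concatE L n L' q)) p s ≤ r

-- ms_r(ℓ,ℓ') ≥ t : the largest admissible s (0 ≤ s ≤ |E(H)|+|E(H')|)
-- is at least t, i.e. some admissible s ≥ t exists.
MsAtLeast : (r : ℕ) → (L : ℕ → Edge) → (n : ℕ) → (L' : ℕ → Edge) → (n' : ℕ)
          → (t : ℕ) → Set
MsAtLeast r L n L' n' t =
  Σ ℕ λ s → t ≤ s × s ≤ n + n' × WindowsOK r L n L' n' s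

MsWalecki≥ : (r m i j t : ℕ) → Set
MsWalecki≥ r m i j t =
  MsAtLeast r (edgeAt m i) (suc (2 * m)) (edgeAt m j) (suc (2 * m)) t

-- A vertex v lies on exactly two edges of H_c, at positions lo and m + hi of ℓ_c, where lo is
-- the distance from v to c in the cycle Z_{2m} and hi ∈ {lo, lo + 1} (for ∞: positions 0 and m).
-- Passing from c to c + 1 moves lo and hi by at most one, so the positions of v in ℓ_i and in ℓ_j
-- differ by at most |i − j|. In the concatenation of ℓ_i and ℓ_j the vertex therefore occurs at
-- four positions whose consecutive gaps are at least the claimed bound for ms, and whose outer
-- two are further apart than the claimed bound for ms_3; a window of that length meets at most
-- one, respectively three, of them.

module Submission where

open import Defs
open import Data.Nat using (ℕ; zero; suc; _+_; _*_; _∸_; _≤_; _<_; _<ᵇ_; z≤n; s≤s; s≤s⁻¹; z<s; _≟_; _≡ᵇ_)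
open import Data.Nat.Properties
open import Data.Nat.Tactic.RingSolver using (solve-∀)
open import Data.Bool using (Bool; true; false; if_then_else_; _∨_; T?)
open import Data.Maybe using (just; nothing)
open import Data.List using (List; []; _∷_; map; length)
open import Data.Nat.ListAction using (sum)
open import Data.List.Membership.Propositional using (_∈_)
open import Data.List.Membership.DecPropositional _≟_ using (_∈?_)
open import Data.List.Relation.Unary.Any using (here; there)
open import Data.List.Relation.Unary.All as All using (All; []; _∷_)
open import Data.List.Relation.Unary.Linked using (Linked; []; [-]; _∷_)
open import Data.List.Relation.Unary.Linked.Properties using (Linked⇒All)
open import Data.Product using (∃; ∃₂; _×_; _,_; proj₁; proj₂)
open import Data.Sum using (_⊎_; inj₁; inj₂; [_,_]′)
open import Data.Empty using (⊥-elim)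
open import Function using (_∘_)
open import Relation.Nullary using (¬_; yes; no; does)
open import Relation.Nullary.Decidable using (dec-true; dec-false)
open import Relation.Binary.PropositionalEquality
open import Relation.Binary.Definitions using (tri<; tri≈; tri>)
open import Algebra.Properties.CommutativeSemigroup +-commutativeSemigroup using (interchange)

<⇒<ᵇ≡true : ∀ {a b} → a < b → (a <ᵇ b) ≡ true
<⇒<ᵇ≡true {a} {b} a<b = dec-true (T? (a <ᵇ b)) (<⇒<ᵇ a<b)

≮⇒<ᵇ≡false : ∀ {a b} → ¬ a < b → (a <ᵇ b) ≡ false
≮⇒<ᵇ≡false {a} {b} a≮b = dec-false (T? (a <ᵇ b)) (a≮b ∘ <ᵇ⇒< a b)

red-< : ∀ m {x} → x < 2 * m → red m x ≡ x
red-< m x<2m rewrite <⇒<ᵇ≡true x<2m = refl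

red-+2m : ∀ m y → red m (y + 2 * m) ≡ y
red-+2m m y rewrite ≮⇒<ᵇ≡false (≤⇒≯ (m≤n+m (2 * m) y)) = m+n∸n≡m y (2 * m)

incident⇒endpoint : ∀ v {a b} → incident v (a , b) ≡ true → v ≡ a ⊎ v ≡ b
incident⇒endpoint v {a} {b} h with v ≟V a | v ≟V b
... | yes v≡a | _      = inj₁ v≡a
... | no _    | yes v≡b = inj₂ v≡b
incident⇒endpoint v () | no _ | no _

2*m≡m+m : ∀ m → 2 * m ≡ m + m
2*m≡m+m m = cong (m +_) (+-identityʳ m)

<+≤⇒<2* : ∀ {c lo m} → c < m → lo ≤ m → c + lo < 2 * m
<+≤⇒<2* {c} {lo} {m} c<m lo≤m = subst (c + lo <_) (sym (2*m≡m+m m)) (+-mono-<-≤ c<m lo≤m)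

edgeAt-chord : ∀ m c {k} → 0 < k → k < m → edgeAt m c k ≡ (c ⊕[ m ] k , c ⊖[ m ] k)
edgeAt-chord m c {suc k} _ k<m rewrite <⇒<ᵇ≡true k<m = refl

edgeAt-apex : ∀ n c → edgeAt (suc n) c (suc n) ≡ (∞ , c ⊕[ suc n ] suc n)
edgeAt-apex n c rewrite ≮⇒<ᵇ≡false (<-irrefl {suc n} refl) | <⇒<ᵇ≡true (n<1+n (suc n)) = refl

edgeAt-zigzag : ∀ m c x →
  edgeAt m c (m + suc x) ≡ (c ⊕[ m ] suc x , (c + 1) ⊖[ m ] suc x)
edgeAt-zigzag m c x
  rewrite +-suc m x
        | ≮⇒<ᵇ≡false (≤⇒≯ (m≤n⇒m≤1+n (m≤m+n m x)))
        | ≮⇒<ᵇ≡false (≤⇒≯ (s≤s (m≤m+n m x)))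
        | trans (cong (_∸ m) (sym (+-suc m x))) (m+n∸m≡n m (suc x)) = refl

data Slot : ℕ → ℕ → Set where
  start  : ∀ {m} → Slot m 0
  chord  : ∀ {m k} → 0 < k → k < m → Slot m k
  apex   : ∀ {n} → Slot (suc n) (suc n)
  zigzag : ∀ {m x} → x < m → Slot m (m + suc x)

slot : ∀ m {k} → k ≤ 2 * m → Slot m k
slot m {zero} _ = start
slot m {suc k} k≤2m with <-cmp (suc k) m
... | tri< k<m _ _ = chord z<s k<m
... | tri≈ _ refl _ = apex
... | tri> _ _ m<k with m≤n⇒∃[o]m+o≡n m<k
...   | x , refl = subst (Slot m) (+-suc m x) (zigzag x<m)
  where
    x<m : x < m
    x<m = +-cancelˡ-≤ m (suc x) m
            (subst (_≤ m + m) (sym (+-suc m x)) (subst (suc (m + x) ≤_) (2*m≡m+m m) k≤2m))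

-- Positions of a vertex

-- In H_c the vertex v lies on the edges at positions lo and m + hi, and on no
-- other; the four cases are v = ∞, v = c − lo, v = c + lo and v = c − lo + 2m.
data Positions (m c : ℕ) : Vertex → ℕ → ℕ → Set where
  at-∞     : Positions m c ∞ 0 0
  at-minus : ∀ {a lo} → a + lo ≡ c → Positions m c (just a) lo (suc lo)
  at-plus  : ∀ {a lo} → c + lo ≡ a → 0 < lo → lo ≤ m → Positions m c (just a) lo lo
  at-wrap  : ∀ {a lo} → a + lo ≡ 2 * m + c → lo < m → a < 2 * m → Positions m c (just a) lo (suc lo)

<m⇒<2m : ∀ {c m} → c < m → c < 2 * m
<m⇒<2m {c} {m} c<m = <-≤-trans c<m (m≤m+n m (m + 0))

plus-positions : ∀ {m c lo} → c < m → 0 < lo → lo ≤ m → Positions m c (c ⊕[ m ] lo) lo lo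
plus-positions {m} {c} {lo} c<m 0<lo lo≤m
  rewrite red-< m (<+≤⇒<2* c<m lo≤m) = at-plus refl 0<lo lo≤m

⊖-no-wrap : ∀ m lo a → lo ≤ 2 * m → (lo + a) ⊖[ m ] lo ≡ just a
⊖-no-wrap m lo a lo≤2m = cong just (trans (cong (red m) shift) (red-+2m m a))
  where
    open ≡-Reasoning
    shift : lo + a + (2 * m ∸ lo) ≡ a + 2 * m
    shift = begin
      lo + a + (2 * m ∸ lo)   ≡⟨ cong (_+ (2 * m ∸ lo)) (+-comm lo a) ⟩
      a + lo + (2 * m ∸ lo)   ≡⟨ +-assoc a lo _ ⟩
      a + (lo + (2 * m ∸ lo)) ≡⟨ cong (a +_) (m+[n∸m]≡n lo≤2m) ⟩
      a + 2 * m               ∎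

minus-positions : ∀ {m c lo} → c < m → lo < m → Positions m c (c ⊖[ m ] lo) lo (suc lo)
minus-positions {m} {c} {lo} c<m lo<m with lo ≤? c
... | yes lo≤c with m≤n⇒∃[o]m+o≡n lo≤c
...   | a , refl rewrite ⊖-no-wrap m lo a (<⇒≤ (<m⇒<2m lo<m)) = at-minus (+-comm a lo)
minus-positions {m} {c} {lo} c<m lo<m | no lo≰c =
  subst (λ a → Positions m c (just a) lo (suc lo)) (sym (red-< m a<2m)) (at-wrap wrap lo<m a<2m)
  where
    lo+u≡2m : lo + (2 * m ∸ lo) ≡ 2 * m
    lo+u≡2m = m+[n∸m]≡n (<⇒≤ (<m⇒<2m lo<m))
    a<2m : c + (2 * m ∸ lo) < 2 * m
    a<2m = subst (c + (2 * m ∸ lo) <_) lo+u≡2m (+-monoˡ-< (2 * m ∸ lo) (≰⇒> lo≰c))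
    wrap : c + (2 * m ∸ lo) + lo ≡ 2 * m + c
    wrap = begin
      c + (2 * m ∸ lo) + lo  ≡⟨ +-assoc c _ lo ⟩
      c + ((2 * m ∸ lo) + lo) ≡⟨ cong (c +_) (m∸n+n≡m (<⇒≤ (<m⇒<2m lo<m))) ⟩
      c + 2 * m              ≡⟨ +-comm c (2 * m) ⟩
      2 * m + c              ∎
      where open ≡-Reasoning

suc-⊖-suc : ∀ m c {x} → x < 2 * m → (c + 1) ⊖[ m ] suc x ≡ c ⊖[ m ] x
suc-⊖-suc m c {x} x<2m = cong (just ∘ red m) (begin
  c + 1 + (2 * m ∸ suc x)   ≡⟨ +-assoc c 1 _ ⟩
  c + (1 + (2 * m ∸ suc x)) ≡⟨ cong (c +_) (+-∸-assoc 1 x<2m) ⟨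
  c + (2 * m ∸ x)           ∎)
  where open ≡-Reasoning

OnEdgeAt : ℕ → ℕ → Vertex → ℕ → Set
OnEdgeAt m c v k = ∃₂ λ lo hi → Positions m c v lo hi × (k ≡ lo ⊎ k ≡ m + hi)

incident⇒OnEdgeAt : ∀ {m c k} v → c < m → Slot m k →
                    incident v (edgeAt m c k) ≡ true → OnEdgeAt m c v k
incident⇒OnEdgeAt {m} {c} v c<m start h with incident⇒endpoint v h
... | inj₁ refl = _ , _ , at-∞ , inj₁ refl
... | inj₂ refl rewrite +-identityʳ c | red-< m (<m⇒<2m c<m) = _ , _ , at-minus (+-identityʳ c) , inj₁ refl
incident⇒OnEdgeAt {m} {c} v c<m (chord 0<k k<m) h
  rewrite edgeAt-chord m c 0<k k<m with incident⇒endpoint v h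
... | inj₁ refl = _ , _ , plus-positions c<m 0<k (<⇒≤ k<m) , inj₁ refl
... | inj₂ refl = _ , _ , minus-positions c<m k<m , inj₁ refl
incident⇒OnEdgeAt {suc n} {c} v c<m apex h
  rewrite edgeAt-apex n c with incident⇒endpoint v h
... | inj₁ refl = _ , _ , at-∞ , inj₂ (sym (+-identityʳ (suc n)))
... | inj₂ refl = _ , _ , plus-positions c<m z<s ≤-refl , inj₁ refl
incident⇒OnEdgeAt {m} {c} v c<m (zigzag {x = x} x<m) h
  rewrite edgeAt-zigzag m c x with incident⇒endpoint v h
... | inj₁ refl = _ , _ , plus-positions c<m z<s x<m , inj₂ refl
... | inj₂ refl = subst (λ w → OnEdgeAt m c w (m + suc x)) (sym (suc-⊖-suc m c (<m⇒<2m x<m)))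
                   (_ , _ , minus-positions c<m x<m , inj₂ refl)

2*m+c≡c+m+m : ∀ m c → 2 * m + c ≡ c + m + m
2*m+c≡c+m+m = solve-∀

minus⇒≤ : ∀ {a lo c} → a + lo ≡ c → a ≤ c
minus⇒≤ {a} {lo} e = subst (a ≤_) e (m≤m+n a lo)

plus⇒> : ∀ {a lo c} → c + lo ≡ a → 0 < lo → c < a
plus⇒> {c = c} e 0<lo = subst (c <_) e (m<m+n c 0<lo)

plus⇒≤ : ∀ {a lo c m} → c + lo ≡ a → lo ≤ m → a ≤ c + m
plus⇒≤ {c = c} e lo≤m = subst (_≤ c + _) e (+-monoʳ-≤ c lo≤m)

wrap⇒> : ∀ {a lo c m} → a + lo ≡ 2 * m + c → lo < m → c + m < a
wrap⇒> {a} {lo} {c} {m} e lo<m = +-cancelʳ-< lo (c + m) a (begin-strict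
  c + m + lo <⟨ +-monoʳ-< (c + m) lo<m ⟩
  c + m + m  ≡⟨ 2*m+c≡c+m+m m c ⟨
  2 * m + c  ≡⟨ e ⟨
  a + lo     ∎)
  where open ≤-Reasoning

+-suc-cancelˡ : ∀ a {x y} → a + x ≡ suc (a + y) → x ≡ suc y
+-suc-cancelˡ a {x} {y} e = +-cancelˡ-≡ a x (suc y) (trans e (sym (+-suc a y)))

Positions-unique : ∀ {m c v lo hi lo' hi'} → Positions m c v lo hi → Positions m c v lo' hi' →
                   lo ≡ lo' × hi ≡ hi'
Positions-unique at-∞ at-∞ = refl , refl
Positions-unique (at-minus {a} e) (at-minus e') =
  let lo≡lo' = +-cancelˡ-≡ a _ _ (trans e (sym e')) in lo≡lo' , cong suc lo≡lo'
Positions-unique (at-plus refl _ _) (at-plus e' _ _) =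
  let lo≡lo' = +-cancelˡ-≡ _ _ _ (sym e') in lo≡lo' , lo≡lo'
Positions-unique (at-wrap {a} e _ _) (at-wrap e' _ _) =
  let lo≡lo' = +-cancelˡ-≡ a _ _ (trans e (sym e')) in lo≡lo' , cong suc lo≡lo'
Positions-unique (at-minus e) (at-plus e' 0<lo' _) = ⊥-elim (<⇒≱ (plus⇒> e' 0<lo') (minus⇒≤ e))
Positions-unique (at-plus e 0<lo _) (at-minus e') = ⊥-elim (<⇒≱ (plus⇒> e 0<lo) (minus⇒≤ e'))
Positions-unique {c = c} (at-minus e) (at-wrap e' lo'<m _) =
  ⊥-elim (<⇒≱ (wrap⇒> e' lo'<m) (≤-trans (minus⇒≤ e) (m≤m+n c _)))
Positions-unique {c = c} (at-wrap e lo<m _) (at-minus e') =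
  ⊥-elim (<⇒≱ (wrap⇒> e lo<m) (≤-trans (minus⇒≤ e') (m≤m+n c _)))
Positions-unique (at-plus e _ lo≤m) (at-wrap e' lo'<m _) = ⊥-elim (<⇒≱ (wrap⇒> e' lo'<m) (plus⇒≤ e lo≤m))
Positions-unique (at-wrap e lo<m _) (at-plus e' _ lo'≤m) = ⊥-elim (<⇒≱ (wrap⇒> e lo<m) (plus⇒≤ e' lo'≤m))

Positions-exist : ∀ {m c a} → c < m → a < 2 * m → ∃₂ (Positions m c (just a))
Positions-exist {m} {c} {a} c<m a<2m with a ≤? c | a ≤? c + m
... | yes a≤c | _ with m≤n⇒∃[o]m+o≡n a≤c
...   | lo , e = lo , suc lo , at-minus e
Positions-exist {m} {c} {a} c<m a<2m | no a≰c | yes a≤c+m with m≤n⇒∃[o]m+o≡n (<⇒≤ (≰⇒> a≰c))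
... | zero  , e = ⊥-elim (a≰c (≤-reflexive (trans (sym e) (+-identityʳ c))))
... | suc k , e = suc k , suc k , at-plus e z<s (+-cancelˡ-≤ c (suc k) m (subst (_≤ c + m) (sym e) a≤c+m))
Positions-exist {m} {c} {a} c<m a<2m | no a≰c | no a≰c+m
  with m≤n⇒∃[o]m+o≡n (≤-trans (<⇒≤ a<2m) (m≤m+n (2 * m) c))
... | lo , e = lo , suc lo , at-wrap e lo<m a<2m
  where
    lo<m : lo < m
    lo<m = +-cancelˡ-< (c + m) lo m (begin-strict
      c + m + lo <⟨ +-monoˡ-< lo (≰⇒> a≰c+m) ⟩
      a + lo     ≡⟨ e ⟩
      2 * m + c  ≡⟨ 2*m+c≡c+m+m m c ⟩
      c + m + m  ∎)
      where open ≤-Reasoning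

Positions⇒<2m : ∀ {m c a lo hi} → c < m → Positions m c (just a) lo hi → a < 2 * m
Positions⇒<2m c<m (at-minus e)        = <m⇒<2m (≤-<-trans (minus⇒≤ e) c<m)
Positions⇒<2m c<m (at-plus refl _ lo≤m) = <+≤⇒<2* c<m lo≤m
Positions⇒<2m c<m (at-wrap _ _ a<2m)  = a<2m

Positions-transfer : ∀ {m c c' v lo hi} → c < m → c' < m → Positions m c v lo hi → ∃₂ (Positions m c' v)
Positions-transfer c<m c'<m at-∞ = 0 , 0 , at-∞
Positions-transfer {v = just a} c<m c'<m P = Positions-exist c'<m (Positions⇒<2m c<m P)

lo≤hi : ∀ {m c v lo hi} → Positions m c v lo hi → lo ≤ hi
lo≤hi at-∞           = z≤n
lo≤hi (at-minus _)   = n≤1+n _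
lo≤hi (at-plus _ _ _) = ≤-refl
lo≤hi (at-wrap _ _ _) = n≤1+n _

hi≤1+lo : ∀ {m c v lo hi} → Positions m c v lo hi → hi ≤ suc lo
hi≤1+lo at-∞           = z≤n
hi≤1+lo (at-minus _)   = ≤-refl
hi≤1+lo (at-plus _ _ _) = n≤1+n _
hi≤1+lo (at-wrap _ _ _) = ≤-refl

sum≡2m⇒both≡m : ∀ {x y m} → x + y ≡ m + m → x ≤ m → y ≤ m → x ≡ m × y ≡ m
sum≡2m⇒both≡m {x} {y} {m} e x≤m y≤m =
  ≤-antisym x≤m (≮⇒≥ (λ x<m → <-irrefl e (+-mono-<-≤ x<m y≤m))) ,
  ≤-antisym y≤m (≮⇒≥ (λ y<m → <-irrefl e (+-mono-≤-< x≤m y<m)))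

Positions-suc : ∀ {m c v lo hi lo' hi'} → Positions m c v lo hi → Positions m (suc c) v lo' hi' →
                lo' ≤ hi × hi ≤ suc lo'
Positions-suc at-∞ at-∞ = z≤n , z≤n
Positions-suc (at-minus {a} e) (at-minus e') with +-suc-cancelˡ a (trans e' (cong suc (sym e)))
... | refl = ≤-refl , n≤1+n _
Positions-suc (at-wrap {a} e _ _) (at-wrap e' _ _)
  with +-suc-cancelˡ a (trans e' (trans (+-suc _ _) (cong suc (sym e))))
... | refl = ≤-refl , n≤1+n _
Positions-suc {c = c} (at-plus refl _ _) (at-plus e' _ _) with +-suc-cancelˡ c (sym e')
... | refl = n≤1+n _ , ≤-refl
Positions-suc {c = c} (at-plus {lo = lo} refl 0<lo _) (at-minus {lo = lo'} e') =
  ≤-trans (subst (lo' ≤_) lo+lo'≡1 (m≤n+m lo' lo)) 0<lo ,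
  ≤-trans (subst (lo ≤_) lo+lo'≡1 (m≤m+n lo lo')) (s≤s z≤n)
  where
    lo+lo'≡1 : lo + lo' ≡ 1
    lo+lo'≡1 = +-cancelˡ-≡ c _ 1 (trans (sym (+-assoc c lo lo')) (trans e' (+-comm 1 c)))
Positions-suc {m} {c} (at-wrap {lo = lo} e lo<m _) (at-plus {lo = lo'} refl _ lo'≤m)
  with sum≡2m⇒both≡m {suc lo} {lo'} {m} sum≡2m lo<m lo'≤m
  where
    sum≡2m : suc lo + lo' ≡ m + m
    sum≡2m = +-cancelˡ-≡ c _ _ (begin
      c + (suc lo + lo')   ≡⟨ cong (c +_) (+-comm (suc lo) lo') ⟩
      c + (lo' + suc lo)   ≡⟨ sym (+-assoc c lo' (suc lo)) ⟩
      c + lo' + suc lo     ≡⟨ +-suc (c + lo') lo ⟩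
      suc c + lo' + lo     ≡⟨ e ⟩
      2 * m + c            ≡⟨ 2*m+c≡c+m+m m c ⟩
      c + m + m            ≡⟨ +-assoc c m m ⟩
      c + (m + m)          ∎)
      where open ≡-Reasoning
... | 1+lo≡m , lo'≡m =
  ≤-reflexive (trans lo'≡m (sym 1+lo≡m)) , ≤-trans (≤-reflexive (trans 1+lo≡m (sym lo'≡m))) (n≤1+n _)
Positions-suc {c = c} (at-minus e) (at-plus e' 0<lo' _) =
  ⊥-elim (<⇒≱ (plus⇒> e' 0<lo') (≤-trans (minus⇒≤ e) (n≤1+n c)))
Positions-suc {c = c} (at-minus e) (at-wrap e' lo'<m _) =
  ⊥-elim (<⇒≱ (wrap⇒> e' lo'<m) (≤-trans (minus⇒≤ e) (≤-trans (n≤1+n c) (m≤m+n (suc c) _))))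
Positions-suc (at-plus e _ lo≤m) (at-wrap e' lo'<m _) =
  ⊥-elim (<⇒≱ (wrap⇒> e' lo'<m) (≤-trans (plus⇒≤ e lo≤m) (n≤1+n _)))
Positions-suc {m} {c} (at-wrap e lo<m _) (at-minus e') =
  ⊥-elim (<⇒≱ (wrap⇒> e lo<m)
                (≤-trans (minus⇒≤ e') (subst (_≤ c + m) (+-comm c 1) (+-monoʳ-≤ c (≤-trans z<s lo<m)))))

-- Comparing ℓ_c with ℓ_{c+d}

module BoundedDrift {Q : ℕ → ℕ → Set} {k : ℕ}
  (unique : ∀ {c x y} → Q c x → Q c y → x ≡ y)
  (total : ∀ {c} → c < k → ∃ (Q c)) where

  open ≤-Reasoning

  private
    at+0 : ∀ {c y} → Q (c + 0) y → Q c y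
    at+0 {c} {y} = subst (λ c' → Q c' y) (+-identityʳ c)

    at+suc : ∀ {c d y} → Q (c + suc d) y → Q (suc (c + d)) y
    at+suc {c} {d} {y} = subst (λ c' → Q c' y) (+-suc c d)

    shorter : ∀ {c d} → c + suc d < k → c + d < k
    shorter {c} {d} = <-trans (+-monoʳ-< c (n<1+n d))

  descent : (∀ {c x y} → Q c x → Q (suc c) y → x ≤ suc y) →
            ∀ {c x y} d → c + d < k → Q c x → Q (c + d) y → x ≤ y + d
  descent step {y = y} zero _ qx qy =
    ≤-reflexive (trans (unique qx (at+0 qy)) (sym (+-identityʳ y)))
  descent step {x = x} {y} (suc d) lt qx qy with total (shorter lt)
  ... | z , qz = begin
    x         ≤⟨ descent step d (shorter lt) qx qz ⟩
    z + d     ≤⟨ +-monoˡ-≤ d (step qz (at+suc qy)) ⟩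
    suc y + d ≡⟨ +-suc y d ⟨
    y + suc d ∎

  ascent : (∀ {c x y} → Q c x → Q (suc c) y → y ≤ suc x) →
           ∀ {c x y} d → c + d < k → Q c x → Q (c + d) y → y ≤ x + d
  ascent step {x = x} zero _ qx qy =
    ≤-reflexive (trans (unique (at+0 qy) qx) (sym (+-identityʳ x)))
  ascent step {x = x} {y} (suc d) lt qx qy with total (shorter lt)
  ... | z , qz = begin
    y           ≤⟨ step qz (at+suc qy) ⟩
    suc z       ≤⟨ s≤s (ascent step d (shorter lt) qx qz) ⟩
    suc (x + d) ≡⟨ +-suc x d ⟨
    x + suc d   ∎

module PositionDrift {m c₀ lo₀ hi₀ : ℕ} {v : Vertex} (c₀<m : c₀ < m) (P₀ : Positions m c₀ v lo₀ hi₀) where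

  positions : ∀ {c} → c < m → ∃₂ (Positions m c v)
  positions c<m = Positions-transfer c₀<m c<m P₀

  private
    LoAt HiAt : ℕ → ℕ → Set
    LoAt c lo = ∃ (Positions m c v lo)
    HiAt c hi = ∃ λ lo → Positions m c v lo hi

    lo-unique : ∀ {c lo lo'} → LoAt c lo → LoAt c lo' → lo ≡ lo'
    lo-unique (_ , P) (_ , P') = proj₁ (Positions-unique P P')

    hi-unique : ∀ {c hi hi'} → HiAt c hi → HiAt c hi' → hi ≡ hi'
    hi-unique (_ , P) (_ , P') = proj₂ (Positions-unique P P')

    lo-total : ∀ {c} → c < m → ∃ (LoAt c)
    lo-total c<m with positions c<m
    ... | lo , hi , P = lo , hi , P

    hi-total : ∀ {c} → c < m → ∃ (HiAt c)
    hi-total c<m with positions c<m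
    ... | lo , hi , P = hi , lo , P

    module Lo = BoundedDrift lo-unique lo-total
    module Hi = BoundedDrift hi-unique hi-total

  lo-ascent : ∀ {c lo hi lo' hi'} d → c + d < m →
              Positions m c v lo hi → Positions m (c + d) v lo' hi' → lo' ≤ lo + d
  lo-ascent d lt P P' =
    Lo.ascent (λ (_ , Q) (_ , Q') → ≤-trans (proj₁ (Positions-suc Q Q')) (hi≤1+lo Q))
              d lt (_ , P) (_ , P')

  hi-ascent : ∀ {c lo hi lo' hi'} d → c + d < m →
              Positions m c v lo hi → Positions m (c + d) v lo' hi' → hi' ≤ hi + d
  hi-ascent d lt P P' =
    Hi.ascent (λ (_ , Q) (_ , Q') → ≤-trans (hi≤1+lo Q') (s≤s (proj₁ (Positions-suc Q Q'))))
              d lt (_ , P) (_ , P')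

  hi-descent : ∀ {c lo hi lo' hi'} d → c + d < m →
               Positions m c v lo hi → Positions m (c + d) v lo' hi' → hi ≤ hi' + d
  hi-descent d lt P P' =
    Hi.descent (λ (_ , Q) (_ , Q') → ≤-trans (proj₂ (Positions-suc Q Q')) (s≤s (lo≤hi Q')))
               d lt (_ , P) (_ , P')

forward-gap : ∀ {m i d v lo hi lo' hi'} → suc (i + d) < m →
  Positions m i v lo hi → Positions m (suc (i + d)) v lo' hi' → hi ≤ lo' + suc d
forward-gap {m} {i} {d} {v} {hi = hi} {lo'} j<m P Q = via (positions i+d<m)
  where
    i+d<m : i + d < m
    i+d<m = <-trans (n<1+n (i + d)) j<m
    open PositionDrift (≤-<-trans (m≤m+n i d) i+d<m) P
    open ≤-Reasoning
    via : ∃₂ (Positions m (i + d) v) → hi ≤ lo' + suc d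
    via (lo₁ , hi₁ , P₁) = begin
      hi          ≤⟨ hi-descent d i+d<m P P₁ ⟩
      hi₁ + d     ≤⟨ +-monoˡ-≤ d (proj₂ (Positions-suc P₁ Q)) ⟩
      suc lo' + d ≡⟨ +-suc lo' d ⟨
      lo' + suc d ∎

backward-gap : ∀ {m j d v lo hi lo' hi'} → suc (j + d) < m →
  Positions m (suc (j + d)) v lo hi → Positions m j v lo' hi' → hi ≤ lo' + suc (suc d) × lo ≤ hi' + d
backward-gap {m} {j} {d} {v} {lo} {hi} {lo'} {hi'} i<m P Q = via (positions j+d<m)
  where
    j+d<m : j + d < m
    j+d<m = <-trans (n<1+n (j + d)) i<m
    open PositionDrift (≤-<-trans (m≤m+n j d) j+d<m) Q
    open ≤-Reasoning
    via : ∃₂ (Positions m (j + d) v) → hi ≤ lo' + suc (suc d) × lo ≤ hi' + d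
    via (lo₁ , hi₁ , P₁) = (begin
      hi                ≤⟨ hi≤1+lo P ⟩
      suc lo            ≤⟨ s≤s (proj₁ (Positions-suc P₁ P)) ⟩
      suc hi₁           ≤⟨ s≤s (hi≤1+lo P₁) ⟩
      suc (suc lo₁)     ≤⟨ s≤s (s≤s (lo-ascent d j+d<m Q P₁)) ⟩
      suc (suc (lo' + d)) ≡⟨ trans (+-suc lo' (suc d)) (cong suc (+-suc lo' d)) ⟨
      lo' + suc (suc d) ∎) , (begin
      lo                ≤⟨ proj₁ (Positions-suc P₁ P) ⟩
      hi₁               ≤⟨ hi-ascent d j+d<m Q P₁ ⟩
      hi' + d           ∎)

-- Counting in a window

𝟙 : Bool → ℕ
𝟙 b = if b then 1 else 0

𝟙-∨ : ∀ a b → 𝟙 (a ∨ b) ≤ 𝟙 a + 𝟙 b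
𝟙-∨ true  _ = s≤s z≤n
𝟙-∨ false _ = ≤-refl

countFrom-mono : ∀ f g p s → (∀ t → t < s → f (p + t) ≡ true → g (p + t) ≡ true) →
                 countFrom f p s ≤ countFrom g p s
countFrom-mono f g p zero    _   = z≤n
countFrom-mono f g p (suc s) f⇒g with f (p + s) in fp+s | countFrom-mono f g p s (λ t → f⇒g t ∘ m<n⇒m<1+n)
... | true  | shorter rewrite f⇒g s (n<1+n s) fp+s = s≤s shorter
... | false | shorter = ≤-trans shorter (m≤n+m _ _)

countFrom-∨ : ∀ f g p s → countFrom (λ q → f q ∨ g q) p s ≤ countFrom f p s + countFrom g p s
countFrom-∨ f g p zero    = z≤n
countFrom-∨ f g p (suc s) = begin
  𝟙 (f (p + s) ∨ g (p + s)) + countFrom (λ q → f q ∨ g q) p s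
    ≤⟨ +-mono-≤ (𝟙-∨ (f (p + s)) (g (p + s))) (countFrom-∨ f g p s) ⟩
  (𝟙 (f (p + s)) + 𝟙 (g (p + s))) + (countFrom f p s + countFrom g p s)
    ≡⟨ interchange (𝟙 (f (p + s))) (𝟙 (g (p + s))) (countFrom f p s) (countFrom g p s) ⟩
  (𝟙 (f (p + s)) + countFrom f p s) + (𝟙 (g (p + s)) + countFrom g p s) ∎
  where open ≤-Reasoning

occurrences : ℕ → ℕ → ℕ → ℕ
occurrences x = countFrom (λ q → does (q ≟ x))

occurrencesIn : List ℕ → ℕ → ℕ → ℕ
occurrencesIn xs p s = sum (map (λ x → occurrences x p s) xs)

countFrom-∈? : ∀ xs p s → countFrom (λ q → does (q ∈? xs)) p s ≤ occurrencesIn xs p s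
countFrom-∈? []       p zero    = z≤n
countFrom-∈? []       p (suc s) = countFrom-∈? [] p s
countFrom-∈? (x ∷ xs) p s =
  ≤-trans (countFrom-∨ (λ q → does (q ≟ x)) (λ q → does (q ∈? xs)) p s)
          (+-monoʳ-≤ (occurrences x p s) (countFrom-∈? xs p s))

countFrom-support : ∀ f xs p s → (∀ t → t < s → f (p + t) ≡ true → p + t ∈ xs) →
                    countFrom f p s ≤ occurrencesIn xs p s
countFrom-support f xs p s supp =
  ≤-trans (countFrom-mono f _ p s (λ t t<s → dec-true (p + t ∈? xs) ∘ supp t t<s)) (countFrom-∈? xs p s)

occurrences-after : ∀ x p s → p + s ≤ x → occurrences x p s ≡ 0
occurrences-after x p zero    _ = refl
occurrences-after x p (suc s) p+s≤x with p + s ≡ᵇ x | ≡ᵇ⇒≡ (p + s) x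
... | true  | p+s≡x = ⊥-elim (<-irrefl (p+s≡x _) (subst (_≤ x) (+-suc p s) p+s≤x))
... | false | _     = occurrences-after x p s (≤-trans (+-monoʳ-≤ p (n≤1+n s)) p+s≤x)

occurrences-before : ∀ x p s → x < p → occurrences x p s ≡ 0
occurrences-before x p zero    _   = refl
occurrences-before x p (suc s) x<p with p + s ≡ᵇ x | ≡ᵇ⇒≡ (p + s) x
... | true  | p+s≡x = ⊥-elim (<⇒≱ x<p (subst (p ≤_) (p+s≡x _) (m≤m+n p s)))
... | false | _     = occurrences-before x p s x<p

occurrences≤1 : ∀ x p s → occurrences x p s ≤ 1
occurrences≤1 x p zero = z≤n
occurrences≤1 x p (suc s) with p + s ≡ᵇ x | ≡ᵇ⇒≡ (p + s) x
... | true  | p+s≡x = ≤-reflexive (cong suc (occurrences-after x p s (≤-reflexive (p+s≡x _))))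
... | false | _     = occurrences≤1 x p s

Spaced : ℕ → List ℕ → Set
Spaced s = Linked (λ x y → x + s ≤ y)

occurrencesIn-after : ∀ {xs p s} → All (p + s ≤_) xs → occurrencesIn xs p s ≡ 0
occurrencesIn-after []                 = refl
occurrencesIn-after {p = p} {s} (_∷_ {x} p+s≤x rest) =
  cong₂ _+_ (occurrences-after x p s p+s≤x) (occurrencesIn-after {p = p} {s} rest)

occurrencesIn≤length : ∀ xs p s → occurrencesIn xs p s ≤ length xs
occurrencesIn≤length []       p s = z≤n
occurrencesIn≤length (x ∷ xs) p s = +-mono-≤ (occurrences≤1 x p s) (occurrencesIn≤length xs p s)

Spaced⇒occurrencesIn≤1 : ∀ {s xs} p → Spaced s xs → occurrencesIn xs p s ≤ 1
Spaced⇒occurrencesIn≤1 p []  = z≤n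
Spaced⇒occurrencesIn≤1 {s} {x ∷ []} p [-] = occurrencesIn≤length (x ∷ []) p s
Spaced⇒occurrencesIn≤1 {s} {x ∷ y ∷ ys} p (x+s≤y ∷ rest) with x <? p
... | yes x<p = subst (λ n → n + occurrencesIn (y ∷ ys) p s ≤ 1) (sym (occurrences-before x p s x<p))
                      (Spaced⇒occurrencesIn≤1 p rest)
... | no  x≮p = subst (λ n → occurrences x p s + n ≤ 1) (sym (occurrencesIn-after {p = p} {s} later))
                      (≤-trans (≤-reflexive (+-identityʳ _)) (occurrences≤1 x p s))
  where
    spaced-trans : ∀ {a b c} → a + s ≤ b → b + s ≤ c → a + s ≤ c
    spaced-trans {b = b} h h' = ≤-trans h (≤-trans (m≤m+n b s) h')
    later : All (p + s ≤_) (y ∷ ys)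
    later = All.map (≤-trans (+-monoˡ-≤ s (≮⇒≥ x≮p))) (Linked⇒All spaced-trans x+s≤y rest)

occurrencesIn≤3 : ∀ {y z w} p s x → x + s ≤ w → occurrencesIn (x ∷ y ∷ z ∷ w ∷ []) p s ≤ 3
occurrencesIn≤3 {y} {z} {w} p s x x+s≤w with x <? p
... | yes x<p = subst (λ n → n + occurrencesIn (y ∷ z ∷ w ∷ []) p s ≤ 3) (sym (occurrences-before x p s x<p))
                      (occurrencesIn≤length (y ∷ z ∷ w ∷ []) p s)
... | no  x≮p = subst (λ n → occurrences x p s + (occurrences y p s + (occurrences z p s + (n + 0))) ≤ 3)
                      (sym (occurrences-after w p s (≤-trans (+-monoˡ-≤ s (≮⇒≥ x≮p)) x+s≤w)))
                      (occurrencesIn≤length (x ∷ y ∷ z ∷ []) p s)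

-- Windows of the concatenated list

cycleLength : ℕ → ℕ
cycleLength m = suc (2 * m)

concatPositions : ℕ → ℕ → ℕ → ℕ → ℕ → List ℕ
concatPositions m lo hi lo' hi' = lo ∷ m + hi ∷ cycleLength m + lo' ∷ cycleLength m + (m + hi') ∷ []

concatE-< : ∀ L n L' {q} → q < n → concatE L n L' q ≡ L q
concatE-< L n L' q<n rewrite <⇒<ᵇ≡true q<n = refl

concatE-+ : ∀ L n L' r → concatE L n L' (n + r) ≡ L' r
concatE-+ L n L' r rewrite ≮⇒<ᵇ≡false (≤⇒≯ (m≤m+n n r)) | m+n∸m≡n n r = refl

incident-concat⇒OnEdgeAt : ∀ {m i j q} v → i < m → j < m → q < cycleLength m + cycleLength m →
  incident v (concatE (edgeAt m i) (cycleLength m) (edgeAt m j) q) ≡ true →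
  OnEdgeAt m i v q ⊎ ∃ λ r → q ≡ cycleLength m + r × OnEdgeAt m j v r
incident-concat⇒OnEdgeAt {m} {i} {j} {q} v i<m j<m q<2L h with q <? cycleLength m
... | yes q<L = inj₁ (incident⇒OnEdgeAt v i<m (slot m (s≤s⁻¹ q<L))
                        (subst (λ e → incident v e ≡ true)
                               (concatE-< (edgeAt m i) (cycleLength m) (edgeAt m j) q<L) h))
... | no q≮L with m≤n⇒∃[o]m+o≡n (≮⇒≥ q≮L)
...   | r , refl = inj₂ (r , refl , incident⇒OnEdgeAt v j<m (slot m (s≤s⁻¹ r<L))
                                      (subst (λ e → incident v e ≡ true)
                                             (concatE-+ (edgeAt m i) (cycleLength m) (edgeAt m j) r) h))
  where
    r<L : r < cycleLength m
    r<L = +-cancelˡ-< (cycleLength m) r (cycleLength m) q<2L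

OnEdgeAt⇒∈ : ∀ {m i j v q lo hi lo' hi'} → Positions m i v lo hi → Positions m j v lo' hi' →
  OnEdgeAt m i v q ⊎ ∃ (λ r → q ≡ cycleLength m + r × OnEdgeAt m j v r) →
  q ∈ concatPositions m lo hi lo' hi'
OnEdgeAt⇒∈ P Q (inj₁ (_ , _ , P' , at)) with Positions-unique P' P | at
... | refl , refl | inj₁ refl = here refl
... | refl , refl | inj₂ refl = there (here refl)
OnEdgeAt⇒∈ P Q (inj₂ (_ , refl , _ , _ , Q' , at)) with Positions-unique Q' Q | at
... | refl , refl | inj₁ refl = there (there (here refl))
... | refl , refl | inj₂ refl = there (there (there (here refl)))

OnEdgeAt⇒<2m : ∀ {m c a k} → c < m → OnEdgeAt m c (just a) k → a < 2 * m
OnEdgeAt⇒<2m c<m (_ , _ , P , _) = Positions⇒<2m c<m P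

msWalecki≥ : ∀ {r m i j t} s → i < m → j < m → t ≤ s → s ≤ cycleLength m + cycleLength m →
  (∀ {v lo hi lo' hi'} → Positions m i v lo hi → Positions m j v lo' hi' →
     ∀ p → occurrencesIn (concatPositions m lo hi lo' hi') p s ≤ r) →
  MsWalecki≥ r m i j t
msWalecki≥ {r} {m} {i} {j} s i<m j<m t≤s s≤2L bound = s , t≤s , s≤2L , λ p _ _ p+s≤2L → window p p+s≤2L
  where
    hits : Vertex → ℕ → Bool
    hits v q = incident v (concatE (edgeAt m i) (cycleLength m) (edgeAt m j) q)

    inWindow : ∀ {p t} → p + s ≤ cycleLength m + cycleLength m → t < s → p + t < cycleLength m + cycleLength m
    inWindow {p} p+s≤2L t<s = <-≤-trans (+-monoʳ-< p t<s) p+s≤2L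

    window : ∀ p → p + s ≤ cycleLength m + cycleLength m → ∀ v → countFrom (hits v) p s ≤ r
    window p p+s≤2L nothing =
      ≤-trans (countFrom-support (hits ∞) _ p s λ t t<s h →
                 OnEdgeAt⇒∈ at-∞ at-∞ (incident-concat⇒OnEdgeAt ∞ i<m j<m (inWindow p+s≤2L t<s) h))
              (bound at-∞ at-∞ p)
    window p p+s≤2L (just a) with a <? 2 * m
    ... | yes a<2m with Positions-exist i<m a<2m | Positions-exist j<m a<2m
    ...   | _ , _ , P | _ , _ , Q =
      ≤-trans (countFrom-support (hits (just a)) _ p s λ t t<s h →
                 OnEdgeAt⇒∈ P Q (incident-concat⇒OnEdgeAt (just a) i<m j<m (inWindow p+s≤2L t<s) h))
              (bound P Q p)
    window p p+s≤2L (just a) | no a≮2m =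
      ≤-trans (countFrom-support (hits (just a)) [] p s λ t t<s h →
                 ⊥-elim (a≮2m ([ OnEdgeAt⇒<2m i<m , (λ (_ , _ , at) → OnEdgeAt⇒<2m j<m at) ]′
                                (incident-concat⇒OnEdgeAt (just a) i<m j<m (inWindow p+s≤2L t<s) h))))
              z≤n

+∸-≤ : ∀ {a b K D} → D ≤ K → a + K ≤ b + D → a + (K ∸ D) ≤ b
+∸-≤ {a} {b} {K} {D} D≤K a+K≤b+D = +-cancelʳ-≤ D _ _ (begin
  a + (K ∸ D) + D   ≡⟨ +-assoc a (K ∸ D) D ⟩
  a + (K ∸ D + D)   ≡⟨ cong (a +_) (m∸n+n≡m D≤K) ⟩
  a + K             ≤⟨ a+K≤b+D ⟩
  b + D             ∎)
  where open ≤-Reasoning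

same-cycle-gap : ∀ {m lo hi s} → lo ≤ hi → s ≤ m → lo + s ≤ m + hi
same-cycle-gap {m} {hi = hi} lo≤hi s≤m = ≤-trans (+-mono-≤ lo≤hi s≤m) (≤-reflexive (+-comm hi m))

second-cycle-gap : ∀ {m lo hi s} → lo ≤ hi → s ≤ m → cycleLength m + lo + s ≤ cycleLength m + (m + hi)
second-cycle-gap {m} {lo} {s = s} lo≤hi s≤m =
  ≤-trans (≤-reflexive (+-assoc (cycleLength m) lo s)) (+-monoʳ-≤ (cycleLength m) (same-cycle-gap lo≤hi s≤m))

between-cycles-gap : ∀ {m hi lo' E} → hi ≤ lo' + E → E ≤ suc m →
  m + hi + (suc m ∸ E) ≤ cycleLength m + lo'
between-cycles-gap {m} {hi} {lo'} {E} hi≤lo'+E E≤1+m = +∸-≤ E≤1+m (begin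
  m + hi + suc m           ≡⟨ rearrange m hi ⟩
  cycleLength m + hi       ≤⟨ +-monoʳ-≤ (cycleLength m) hi≤lo'+E ⟩
  cycleLength m + (lo' + E) ≡⟨ +-assoc (cycleLength m) lo' E ⟨
  cycleLength m + lo' + E  ∎)
  where
    open ≤-Reasoning
    rearrange : ∀ m hi → m + hi + suc m ≡ suc (2 * m) + hi
    rearrange = solve-∀

across-cycles-gap : ∀ {m lo hi' E} → lo ≤ hi' + E → E ≤ 3 * m + 1 →
  lo + (3 * m + 1 ∸ E) ≤ cycleLength m + (m + hi')
across-cycles-gap {m} {lo} {hi'} {E} lo≤hi'+E E≤ = +∸-≤ E≤ (begin
  lo + (3 * m + 1)          ≤⟨ +-monoˡ-≤ (3 * m + 1) lo≤hi'+E ⟩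
  hi' + E + (3 * m + 1)     ≡⟨ rearrange m hi' E ⟩
  cycleLength m + (m + hi') + E ∎)
  where
    open ≤-Reasoning
    rearrange : ∀ m hi' E → hi' + E + (3 * m + 1) ≡ suc (2 * m) + (m + hi') + E
    rearrange = solve-∀

3m+1≤2L : ∀ m → 3 * m + 1 ≤ cycleLength m + cycleLength m
3m+1≤2L m = ≤-trans (m≤m+n (3 * m + 1) (m + 1)) (≤-reflexive (regroup m))
  where
    regroup : ∀ m → 3 * m + 1 + (m + 1) ≡ suc (2 * m) + suc (2 * m)
    regroup = solve-∀

1+m≤3m+1 : ∀ m → suc m ≤ 3 * m + 1
1+m≤3m+1 m = subst (_≤ 3 * m + 1) (+-comm m 1) (+-monoˡ-≤ 1 (m≤m+n m (2 * m)))

m≤2L : ∀ m → m ≤ cycleLength m + cycleLength m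
m≤2L m = ≤-trans (≤-trans (n≤1+n m) (1+m≤3m+1 m)) (3m+1≤2L m)

ms-forward : ∀ {m i d} → i < m → suc (i + d) < m →
  MsWalecki≥ 1 m i (suc (i + d)) (m + 1 ∸ suc d) × MsWalecki≥ 3 m i (suc (i + d)) (3 * m + 1 ∸ suc d)
ms-forward {m} {i} {d} i<m j<m =
  msWalecki≥ (m ∸ d) i<m j<m (≤-reflexive (cong (_∸ suc d) (+-comm m 1)))
             (≤-trans (m∸n≤m m d) (m≤2L m))
    (λ P Q p → Spaced⇒occurrencesIn≤1 p
       (same-cycle-gap (lo≤hi P) (m∸n≤m m d) ∷
        between-cycles-gap (forward-gap j<m P Q) (s≤s d≤m) ∷
        second-cycle-gap (lo≤hi Q) (m∸n≤m m d) ∷ [-])) ,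
  msWalecki≥ (3 * m + 1 ∸ suc d) i<m j<m ≤-refl (≤-trans (m∸n≤m (3 * m + 1) (suc d)) (3m+1≤2L m))
    (λ {lo = lo} P Q p → occurrencesIn≤3 p (3 * m + 1 ∸ suc d) lo (across-cycles-gap {m}
       (≤-trans (lo≤hi P) (≤-trans (forward-gap j<m P Q) (+-monoˡ-≤ (suc d) (lo≤hi Q))))
       (≤-trans (s≤s d≤m) (1+m≤3m+1 m))))
  where
    d≤m : d ≤ m
    d≤m = ≤-trans (m≤n+m d i) (≤-trans (n≤1+n (i + d)) (<⇒≤ j<m))

ms-backward : ∀ {m j d} → suc (j + d) < m → j < m →
  MsWalecki≥ 1 m (suc (j + d)) j (m ∸ suc d) × MsWalecki≥ 3 m (suc (j + d)) j (3 * m + 2 ∸ suc d)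
ms-backward {m} {j} {d} i<m j<m =
  msWalecki≥ (m ∸ suc d) i<m j<m ≤-refl (≤-trans (m∸n≤m m (suc d)) (m≤2L m))
    (λ P Q p → Spaced⇒occurrencesIn≤1 p
       (same-cycle-gap (lo≤hi P) (m∸n≤m m (suc d)) ∷
        between-cycles-gap (proj₁ (backward-gap i<m P Q)) (s≤s 1+d≤m) ∷
        second-cycle-gap (lo≤hi Q) (m∸n≤m m (suc d)) ∷ [-])) ,
  msWalecki≥ (3 * m + 1 ∸ d) i<m j<m (≤-reflexive (cong (_∸ suc d) (+-suc (3 * m) 1)))
             (≤-trans (m∸n≤m (3 * m + 1) d) (3m+1≤2L m))
    (λ {lo = lo} P Q p → occurrencesIn≤3 p (3 * m + 1 ∸ d) lo (across-cycles-gap {m}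
       (proj₂ (backward-gap i<m P Q))
       (≤-trans (≤-trans (n≤1+n d) (m≤n⇒m≤1+n 1+d≤m)) (1+m≤3m+1 m))))
  where
    1+d≤m : suc d ≤ m
    1+d≤m = ≤-trans (s≤s (m≤n+m d j)) (<⇒≤ i<m)

lemma29 : ∀ (m : ℕ) → 2 ≤ m → ∀ (i j : ℕ) → i < m → j < m →
    (i < j → MsWalecki≥ 1 m i j (m + 1 ∸ (j ∸ i))
             × MsWalecki≥ 3 m i j (3 * m + 1 ∸ (j ∸ i)))
    × (j < i → MsWalecki≥ 1 m i j (m ∸ (i ∸ j))
             × MsWalecki≥ 3 m i j (3 * m + 2 ∸ (i ∸ j)))
lemma29 m _ i j i<m j<m = forward , backward
  where
    suc[c+d]∸c≡suc[d] : ∀ c d → suc (c + d) ∸ c ≡ suc d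
    suc[c+d]∸c≡suc[d] c d = trans (+-∸-assoc 1 (m≤m+n c d)) (cong suc (m+n∸m≡n c d))

    forward : i < j → MsWalecki≥ 1 m i j (m + 1 ∸ (j ∸ i)) × MsWalecki≥ 3 m i j (3 * m + 1 ∸ (j ∸ i))
    forward i<j with m≤n⇒∃[o]m+o≡n i<j
    ... | d , refl rewrite suc[c+d]∸c≡suc[d] i d = ms-forward i<m j<m

    backward : j < i → MsWalecki≥ 1 m i j (m ∸ (i ∸ j)) × MsWalecki≥ 3 m i j (3 * m + 2 ∸ (i ∸ j))
    backward j<i with m≤n⇒∃[o]m+o≡n j<i
    ... | d , refl rewrite suc[c+d]∸c≡suc[d] j d = ms-backward i<m j<m
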